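{- Let $G$ be a connected partial cube and let $B_1,\ldots,B_k$ be the end blocks of $G$. For each $i\in\{1,\ldots,k\}$ let $\Theta^{i}(G)$ be an arbitrary $\Theta$-class of $G$ that contains an edge of $B_i$. Then $\bigcup_{i=1}^{k}\Theta^{i}(G)$ is an edge general position set of $G$.
   Context: A set of edges $X\subseteq E(G)$ of a graph $G$ is an edge general position set if no three edges of $X$ lie on a common shortest path of $G$. A partial cube is a graph isomorphic to an isometric subgraph of a hypercube $Q_r$ (the graph on $\{0,1\}^r$ with two vertices adjacent iff they differ in exactly one coordinate); a subgraph $H$ is isometric if $d_H(x,y)=d_G(x,y)$ for all $x,y\in V(H)$. Two edges $xy$ and $uv$ of $G$ are in the Djoković–Winkler relation $\Theta$ if $d_G(x,u)+d_G(y,v)\neq d_G(x,v)+d_G(y,u)$; in a partial cube $\Theta$ is an equivalence relation on $E(G)$ and its equivalence classes are called $\Theta$-classes. An end block of $G$ is a block (maximal 2-connected subgraph or bridge) of $G$ that contains exactly one cut vertex of $G$. -}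

module Defs where

open import Data.Nat using (ℕ; zero; suc; _+_; _≤_)
open import Data.Fin using (Fin)
open import Data.Fin.Subset using (Subset; _∈_; _⊆_; ∣_∣)
open import Data.Bool using (Bool; true; false)
open import Data.Vec using (Vec; lookup)
open import Data.Product using (Σ; _×_; _,_)
open import Data.Sum using (_⊎_)
open import Data.Empty using (⊥)
open import Relation.Nullary using (¬_)
open import Relation.Binary.PropositionalEquality using (_≡_; _≢_)

record Graph (n : ℕ) : Set where
  field
    adj    : Fin n → Fin n → Bool
    sym    : ∀ x y → adj x y ≡ adj y x
    irrefl : ∀ x → adj x x ≡ false

open Graph public

E : ∀ {n} → Graph n → Fin n → Fin n → Set
E G x y = adj G x y ≡ true

data Walk {A : Set} (R : A → A → Set) : A → A → ℕ → Set where
  []  : ∀ {x} → Walk R x x zero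
  _∷_ : ∀ {x y z k} → R x y → Walk R y z k → Walk R x z (suc k)

data Steps {A : Set} {R : A → A → Set} (x y : A) :
     ∀ {a b k} → Walk R a b k → Set where
  here  : ∀ {b k} {e : R x y} {w : Walk R y b k} → Steps x y (e ∷ w)
  there : ∀ {a c b k} {e : R a c} {w : Walk R c b k} →
          Steps x y w → Steps x y (e ∷ w)

OnWalk : {A : Set} {R : A → A → Set} (x y : A) →
         ∀ {a b k} → Walk R a b k → Set
OnWalk x y w = Steps x y w ⊎ Steps y x w

SameEdge : {A : Set} → A → A → A → A → Set
SameEdge x y u v = (x ≡ u × y ≡ v) ⊎ (x ≡ v × y ≡ u)

IsDist : {A : Set} (R : A → A → Set) → A → A → ℕ → Set
IsDist R x y k = Walk R x y k × (∀ m → Walk R x y m → k ≤ m)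

ConnectedOn : ∀ {n} → Graph n → (Fin n → Set) → Set
ConnectedOn G P = ∀ x y → P x → P y →
  Σ ℕ λ k → Walk (λ a b → E G a b × P a × P b) x y k

Connected : ∀ {n} → Graph n → Set
Connected G = ∀ x y → Σ ℕ λ k → Walk (E G) x y k

-- cut vertex (of a connected graph): G - v is disconnected
CutVertex : ∀ {n} → Graph n → Fin n → Set
CutVertex G v = Σ _ λ a → Σ _ λ b → a ≢ v × b ≢ v ×
  ¬ (Σ ℕ λ k → Walk (λ x y → E G x y × x ≢ v × y ≢ v) a b k)

-- bridge (of a connected graph): G - xy has no x–y walk
Bridge : ∀ {n} → Graph n → Fin n → Fin n → Set
Bridge G x y = E G x y ×
  ¬ (Σ ℕ λ k → Walk (λ a b → E G a b × ¬ SameEdge a b x y) x y k)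

TwoConnected : ∀ {n} → Graph n → Subset n → Set
TwoConnected G S = 3 ≤ ∣ S ∣ × ConnectedOn G (_∈ S) ×
  (∀ v → v ∈ S → ConnectedOn G (λ x → x ∈ S × x ≢ v))

MaximalTwoConnected : ∀ {n} → Graph n → Subset n → Set
MaximalTwoConnected G S = TwoConnected G S ×
  (∀ T → S ⊆ T → TwoConnected G T → T ≡ S)

-- a block (given by its vertex set; blocks are induced subgraphs):
-- a maximal 2-connected subgraph or (the two ends of) a bridge
IsBlock : ∀ {n} → Graph n → Subset n → Set
IsBlock G S = MaximalTwoConnected G S ⊎
  (Σ _ λ x → Σ _ λ y → Bridge G x y ×
     (∀ z → (z ∈ S → (z ≡ x ⊎ z ≡ y)) × ((z ≡ x ⊎ z ≡ y) → z ∈ S)))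

IsEndBlock : ∀ {n} → Graph n → Subset n → Set
IsEndBlock G S = IsBlock G S ×
  Σ _ λ c → (c ∈ S × CutVertex G c) ×
    (∀ c' → c' ∈ S → CutVertex G c' → c' ≡ c)

QAdj : ∀ {r} → Vec Bool r → Vec Bool r → Set
QAdj {r} u v = Σ (Fin r) λ i → lookup u i ≢ lookup v i ×
  (∀ j → j ≢ i → lookup u j ≡ lookup v j)

-- G is isomorphic (via φ) to an isometric subgraph of Q_r
PartialCube : ∀ {n} → Graph n → Set
PartialCube {n} G = Σ ℕ λ r → Σ (Fin n → Vec Bool r) λ φ →
  (∀ x y → φ x ≡ φ y → x ≡ y) ×
  (∀ x y → E G x y → QAdj (φ x) (φ y)) ×
  (∀ x y k → IsDist (E G) x y k → IsDist QAdj (φ x) (φ y) k)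

Theta : ∀ {n} → Graph n → Fin n → Fin n → Fin n → Fin n → Set
Theta G x y u v = Σ ℕ λ dxu → Σ ℕ λ dyv → Σ ℕ λ dxv → Σ ℕ λ dyu →
  IsDist (E G) x u dxu × IsDist (E G) y v dyv ×
  IsDist (E G) x v dxv × IsDist (E G) y u dyu ×
  dxu + dyv ≢ dxv + dyu

-- X (a set of edges, given as a relation on vertices) is an edge general
-- position set: X ⊆ E(G) and no three distinct edges of X lie on a
-- common shortest path
EdgeGP : ∀ {n} → Graph n → (Fin n → Fin n → Set) → Set
EdgeGP G X = (∀ x y → X x y → E G x y) ×
  (∀ a b k (w : Walk (E G) a b k) → IsDist (E G) a b k →
   ∀ x₁ y₁ x₂ y₂ x₃ y₃ → X x₁ y₁ → X x₂ y₂ → X x₃ y₃ →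
   OnWalk x₁ y₁ w → OnWalk x₂ y₂ w → OnWalk x₃ y₃ w →
   ¬ SameEdge x₁ y₁ x₂ y₂ → ¬ SameEdge x₁ y₁ x₃ y₃ → ¬ SameEdge x₂ y₂ x₃ y₃ →
   ⊥)

-- Embed G isometrically in a hypercube. Every edge flips exactly one coordinate, and
-- Θ-related edges flip the same one: for edges flipping different coordinates the Hamming
-- distances satisfy d(x,u) + d(y,v) = d(x,v) + d(y,u). A shortest path flips each coordinate
-- at most once, so it contains at most one edge of each Θ-class.
--
-- Let Dᵢ be the end block Bᵢ without its cut vertex cᵢ. No edge leaves Dᵢ, so every walk from
-- outside Dᵢ into Bᵢ passes through cᵢ. Hence an edge Θ-related to an edge of Bᵢ has an endpoint
-- in Dᵢ, and a shortest path containing it starts or ends in Dᵢ. The Dᵢ are pairwise disjoint,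
-- so of three edges of ⋃ Θⁱ on a shortest path two have their Dᵢ at the same end of the path;
-- they then lie in the same Θ-class, which is impossible.

module Submission where

open import Defs hiding (sym)
open import Data.Bool using (Bool; true; false; not)
open import Data.Bool.Properties using (¬-not)
open import Data.Empty using (⊥; ⊥-elim)
open import Data.Fin using (Fin; zero; suc; punchIn)
open import Data.Fin.Properties using (punchInᵢ≢i) renaming (_≟_ to _≟ᶠ_)
open import Data.Fin.Subset using (Subset; _∈_; _∉_; _⊆_; _∪_; ⁅_⁆)
open import Data.Fin.Subset.Properties
  using (_∈?_; x∈p∪q⁻; x∈p∪q⁺; x∈⁅x⁆; x∈⁅y⁆⇒x≡y; p⊆q⇒∣p∣≤∣q∣; ⊆-antisym)
open import Data.Nat using (ℕ; zero; suc; _+_; _≤_; z≤n; s≤s)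
open import Data.Nat.Properties
open import Algebra.Properties.CommutativeMonoid.Sum +-0-commutativeMonoid
  using (sum; sum-cong-≗; ∑-distrib-+; sum-remove; sum-replicate-zero)
open import Data.Nat.Tactic.RingSolver using (solve-∀)
open import Data.Product using (Σ; _×_; _,_; proj₁; proj₂)
open import Data.Sum using (_⊎_; inj₁; inj₂)
import Data.Sum as Sum
open import Data.Unit using (⊤; tt)
open import Data.Vec using (Vec; lookup; _∷_; [])
open import Function using (_∘_; id)
open import Relation.Binary.PropositionalEquality
open import Relation.Nullary using (¬_; Dec; yes; no)
open import Relation.Nullary.Decidable using (decidable-stable)

-- Walks

mapʷ : ∀ {A B : Set} {R : A → A → Set} {R′ : B → B → Set} (f : A → B) →
       (∀ {a b} → R a b → R′ (f a) (f b)) → ∀ {x y k} → Walk R x y k → Walk R′ (f x) (f y) k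
mapʷ f g []      = []
mapʷ f g (e ∷ w) = g e ∷ mapʷ f g w

SameEdge-trans : ∀ {A : Set} {x y u v a b : A} → SameEdge x y a b → SameEdge u v a b → SameEdge x y u v
SameEdge-trans (inj₁ (refl , refl)) (inj₁ (refl , refl)) = inj₁ (refl , refl)
SameEdge-trans (inj₁ (refl , refl)) (inj₂ (refl , refl)) = inj₂ (refl , refl)
SameEdge-trans (inj₂ (refl , refl)) (inj₁ (refl , refl)) = inj₂ (refl , refl)
SameEdge-trans (inj₂ (refl , refl)) (inj₂ (refl , refl)) = inj₁ (refl , refl)

SameEdge-swapˡ : ∀ {A : Set} {a b x y : A} → SameEdge a b x y → SameEdge b a x y
SameEdge-swapˡ (inj₁ (a≡x , b≡y)) = inj₂ (b≡y , a≡x)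
SameEdge-swapˡ (inj₂ (a≡y , b≡x)) = inj₁ (b≡x , a≡y)

module Walks {A : Set} {R : A → A → Set} where

  infixr 5 _++ʷ_

  _++ʷ_ : ∀ {x y z k m} → Walk R x y k → Walk R y z m → Walk R x z (k + m)
  []      ++ʷ v = v
  (e ∷ w) ++ʷ v = e ∷ (w ++ʷ v)

  reverseʷ : (∀ {a b} → R a b → R b a) → ∀ {x y k} → Walk R x y k → Walk R y x k
  reverseʷ R-sym []               = []
  reverseʷ R-sym {k = suc k} (e ∷ w) =
    subst (Walk R _ _) (+-comm k 1) (reverseʷ R-sym w ++ʷ (R-sym e ∷ []))

  IsDist-unique : ∀ {x y k m} → IsDist R x y k → IsDist R x y m → k ≡ m
  IsDist-unique (w₁ , min₁) (w₂ , min₂) = ≤-antisym (min₁ _ w₂) (min₂ _ w₁)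

  IsDist-split : ∀ {x u c k m₁ m₂} → IsDist R x u k → Walk R x c m₁ → Walk R c u m₂ →
                 k ≡ m₁ + m₂ → IsDist R x c m₁ × IsDist R c u m₂
  IsDist-split {m₁ = m₁} {m₂} (_ , min) w₁ w₂ refl =
    (w₁ , λ m w → +-cancelʳ-≤ m₂ m₁ m (min _ (w ++ʷ w₂))) ,
    (w₂ , λ m w → +-cancelˡ-≤ m₁ m₂ m (min _ (w₁ ++ʷ w)))

  record Split (F : A → A → Set) (a b : A) (k : ℕ) : Set where
    field
      {u v}     : A
      {k₁ k₂}   : ℕ
      before    : Walk R a u k₁
      step      : R u v
      F-step    : F u v
      after     : Walk R v b k₂
      length    : k ≡ k₁ + suc k₂

  record DoubleSplit (F : A → A → Set) (a b : A) (k : ℕ) : Set where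
    field
      {u₁ v₁ u₂ v₂} : A
      {k₁ k₂ k₃}    : ℕ
      before        : Walk R a u₁ k₁
      step₁         : R u₁ v₁
      F-step₁       : F u₁ v₁
      between       : Walk R v₁ u₂ k₂
      step₂         : R u₂ v₂
      F-step₂       : F u₂ v₂
      after         : Walk R v₂ b k₃
      length        : k ≡ k₁ + suc (k₂ + suc k₃)

  OnWalk-∷⁻ : ∀ {x y a a′ b k} {e : R a a′} {w : Walk R a′ b k} →
              OnWalk x y (e ∷ w) → SameEdge x y a a′ ⊎ OnWalk x y w
  OnWalk-∷⁻ (inj₁ here)      = inj₁ (inj₁ (refl , refl))
  OnWalk-∷⁻ (inj₂ here)      = inj₁ (inj₂ (refl , refl))
  OnWalk-∷⁻ (inj₁ (there s)) = inj₂ (inj₁ s)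
  OnWalk-∷⁻ (inj₂ (there s)) = inj₂ (inj₂ s)

  module _ {F : A → A → Set} (F-sym : ∀ {x y} → F x y → F y x) where

    F-SameEdge : ∀ {x y u v} → SameEdge x y u v → F x y → F u v
    F-SameEdge (inj₁ (refl , refl)) f = f
    F-SameEdge (inj₂ (refl , refl)) f = F-sym f

    Steps-split : ∀ {x y a b k} {w : Walk R a b k} → Steps x y w → F x y → Split F a b k
    Steps-split (here {e = e} {w = w}) f = record
      { before = [] ; step = e ; F-step = f ; after = w ; length = refl }
    Steps-split (there {e = e} s) f = record
      { before = e ∷ before ; step = step ; F-step = F-step ; after = after
      ; length = cong suc length }
      where open Split (Steps-split s f)

    OnWalk-split : ∀ {x y a b k} {w : Walk R a b k} → OnWalk x y w → F x y → Split F a b k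
    OnWalk-split (inj₁ s) f = Steps-split s f
    OnWalk-split (inj₂ s) f = Steps-split s (F-sym f)

    ∷-split : ∀ {a a′ b k} (e : R a a′) → F a a′ → Split F a′ b k → DoubleSplit F a b (suc k)
    ∷-split e f s = record
      { before = [] ; step₁ = e ; F-step₁ = f ; between = before ; step₂ = step
      ; F-step₂ = F-step ; after = after ; length = cong suc length }
      where open Split s

    OnWalk-split₂ : ∀ {x₁ y₁ x₂ y₂ a b k} (w : Walk R a b k) →
                    OnWalk x₁ y₁ w → OnWalk x₂ y₂ w → ¬ SameEdge x₁ y₁ x₂ y₂ →
                    F x₁ y₁ → F x₂ y₂ → DoubleSplit F a b k
    OnWalk-split₂ [] (inj₁ ())
    OnWalk-split₂ [] (inj₂ ())
    OnWalk-split₂ (e ∷ w) o₁ o₂ distinct f₁ f₂ with OnWalk-∷⁻ o₁ | OnWalk-∷⁻ o₂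
    ... | inj₁ s₁ | inj₁ s₂  = ⊥-elim (distinct (SameEdge-trans s₁ s₂))
    ... | inj₁ s₁ | inj₂ o₂′ = ∷-split e (F-SameEdge s₁ f₁) (OnWalk-split o₂′ f₂)
    ... | inj₂ o₁′ | inj₁ s₂ = ∷-split e (F-SameEdge s₂ f₂) (OnWalk-split o₁′ f₁)
    ... | inj₂ o₁′ | inj₂ o₂′ = record
      { before = e ∷ before ; step₁ = step₁ ; F-step₁ = F-step₁ ; between = between
      ; step₂ = step₂ ; F-step₂ = F-step₂ ; after = after ; length = cong suc length }
      where open DoubleSplit (OnWalk-split₂ w o₁′ o₂′ distinct f₁ f₂)

open Walks

-- Hamming distance

δ : Bool → Bool → ℕ
δ false false = 0
δ false true  = 1
δ true  false = 1
δ true  true  = 0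

δ-refl : ∀ a → δ a a ≡ 0
δ-refl false = refl
δ-refl true  = refl

δ≤1 : ∀ a b → δ a b ≤ 1
δ≤1 false false = z≤n
δ≤1 false true  = ≤-refl
δ≤1 true  false = ≤-refl
δ≤1 true  true  = z≤n

δ-triangle : ∀ a b c → δ a c ≤ δ a b + δ b c
δ-triangle false false c     = ≤-refl
δ-triangle true  true  c     = ≤-refl
δ-triangle false true  false = z≤n
δ-triangle false true  true  = ≤-refl
δ-triangle true  false false = ≤-refl
δ-triangle true  false true  = z≤n

δ-not : ∀ a b → δ (not a) (not b) ≡ δ a b
δ-not false false = refl
δ-not false true  = refl
δ-not true  false = refl
δ-not true  true  = refl

δ-negate : ∀ {a a′ b b′} → a ≢ a′ → b ≢ b′ → δ a b ≡ δ a′ b′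
δ-negate {a} {b = b} a≢a′ b≢b′
  rewrite ¬-not (≢-sym a≢a′) | ¬-not (≢-sym b≢b′) = sym (δ-not a b)

δ-swap : ∀ {x y u v} → x ≡ y ⊎ u ≡ v → δ x u + δ y v ≡ δ x v + δ y u
δ-swap {x} {u = u} {v} (inj₁ refl) = +-comm (δ x u) (δ x v)
δ-swap (inj₂ refl) = refl

sum-mono-≤ : ∀ {r} {f g : Fin r → ℕ} → (∀ t → f t ≤ g t) → sum f ≤ sum g
sum-mono-≤ {zero}  f≤g = z≤n
sum-mono-≤ {suc r} f≤g = +-mono-≤ (f≤g zero) (sum-mono-≤ (f≤g ∘ suc))

δ-at : ∀ {r} → Vec Bool r → Vec Bool r → Fin r → ℕ
δ-at p q t = δ (lookup p t) (lookup q t)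

hamming : ∀ {r} → Vec Bool r → Vec Bool r → ℕ
hamming p q = sum (δ-at p q)

record DifferOnlyAt {r} (t : Fin r) (p q : Vec Bool r) : Set where
  constructor _,_
  field
    differs : lookup p t ≢ lookup q t
    agrees  : ∀ j → j ≢ t → lookup p j ≡ lookup q j

module _ {r : ℕ} where

  hamming-refl : (p : Vec Bool r) → hamming p p ≡ 0
  hamming-refl p = trans (sum-cong-≗ (δ-refl ∘ lookup p)) (sum-replicate-zero r)

  hamming-triangle : (p q s : Vec Bool r) → hamming p s ≤ hamming p q + hamming q s
  hamming-triangle p q s = begin
    hamming p s                             ≤⟨ sum-mono-≤ (λ t → δ-triangle _ (lookup q t) _) ⟩
    sum (λ t → δ-at p q t + δ-at q s t)     ≡⟨ ∑-distrib-+ (δ-at p q) (δ-at q s) ⟩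
    hamming p q + hamming q s               ∎
    where open ≤-Reasoning

  hamming-swap : {p q u v : Vec Bool r} → (∀ t → lookup p t ≡ lookup q t ⊎ lookup u t ≡ lookup v t) →
                 hamming p u + hamming q v ≡ hamming p v + hamming q u
  hamming-swap {p} {q} {u} {v} agree = begin
    hamming p u + hamming q v              ≡⟨ ∑-distrib-+ (δ-at p u) (δ-at q v) ⟨
    sum (λ t → δ-at p u t + δ-at q v t)    ≡⟨ sum-cong-≗ (λ t → δ-swap (agree t)) ⟩
    sum (λ t → δ-at p v t + δ-at q u t)    ≡⟨ ∑-distrib-+ (δ-at p v) (δ-at q u) ⟩
    hamming p v + hamming q u              ∎
    where open ≡-Reasoning

  hamming-negate : ∀ {t} {p p′ q q′ : Vec Bool r} → DifferOnlyAt t p p′ → DifferOnlyAt t q q′ →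
                   hamming p q ≡ hamming p′ q′
  hamming-negate {t} {p} {p′} {q} {q′} (p≢p′ , p≡p′) (q≢q′ , q≡q′) = sum-cong-≗ pointwise
    where
    pointwise : ∀ j → δ (lookup p j) (lookup q j) ≡ δ (lookup p′ j) (lookup q′ j)
    pointwise j with j ≟ᶠ t
    ... | yes refl = δ-negate p≢p′ q≢q′
    ... | no j≢t   = cong₂ δ (p≡p′ j j≢t) (q≡q′ j j≢t)

  QAdj-DifferOnlyAt : ∀ {t} {p q : Vec Bool r} → QAdj p q → lookup p t ≢ lookup q t → DifferOnlyAt t p q
  QAdj-DifferOnlyAt {t} (i , p≢q , same) t-differs with t ≟ᶠ i
  ... | yes refl = p≢q , same
  ... | no t≢i   = ⊥-elim (t-differs (same t t≢i))

QAdj⇒hamming≤1 : ∀ {r} {p q : Vec Bool r} → QAdj p q → hamming p q ≤ 1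
QAdj⇒hamming≤1 {suc r} {p} {q} (i , _ , same) = begin
  hamming p q                                ≡⟨ sum-remove {i = i} (δ-at p q) ⟩
  δ-at p q i + sum (δ-at p q ∘ punchIn i)    ≡⟨ cong (δ-at p q i +_) rest≡0 ⟩
  δ-at p q i + 0                             ≤⟨ +-monoˡ-≤ 0 (δ≤1 _ _) ⟩
  1                                          ∎
  where
  open ≤-Reasoning
  rest≡0 : sum (δ-at p q ∘ punchIn i) ≡ 0
  rest≡0 = trans (sum-cong-≗ λ j → trans (cong (δ (lookup p (punchIn i j))) (sym (same _ (punchInᵢ≢i i j))))
                                         (δ-refl _))
                 (sum-replicate-zero r)

walk⇒hamming≤ : ∀ {r} {p q : Vec Bool r} {k} → Walk QAdj p q k → hamming p q ≤ k
walk⇒hamming≤ {p = p} [] = ≤-reflexive (hamming-refl p)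
walk⇒hamming≤ {p = p} {q} (_∷_ {y = s} e w) =
  ≤-trans (hamming-triangle p s q) (+-mono-≤ (QAdj⇒hamming≤1 {p = p} {s} e) (walk⇒hamming≤ w))

∷-QAdj : ∀ {r} a {p q : Vec Bool r} → QAdj p q → QAdj (a ∷ p) (a ∷ q)
∷-QAdj a (i , p≢q , same) = suc i , p≢q , λ { zero _ → refl ; (suc j) j≢i → same j (j≢i ∘ cong suc) }

∷-walk : ∀ {r} a {p q : Vec Bool r} {k} → Walk QAdj p q k → Walk QAdj (a ∷ p) (a ∷ q) k
∷-walk a = mapʷ (a ∷_) (∷-QAdj a)

head-QAdj : ∀ {r a b} (p : Vec Bool r) → a ≢ b → QAdj (a ∷ p) (b ∷ p)
head-QAdj p a≢b = zero , a≢b , λ { zero 0≢0 → ⊥-elim (0≢0 refl) ; (suc j) _ → refl }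

hamming-walk : ∀ {r} (p q : Vec Bool r) → Walk QAdj p q (hamming p q)
hamming-walk [] [] = []
hamming-walk (false ∷ p) (false ∷ q) = ∷-walk false (hamming-walk p q)
hamming-walk (true  ∷ p) (true  ∷ q) = ∷-walk true (hamming-walk p q)
hamming-walk (false ∷ p) (true  ∷ q) = head-QAdj p (λ ()) ∷ ∷-walk true (hamming-walk p q)
hamming-walk (true  ∷ p) (false ∷ q) = head-QAdj p (λ ()) ∷ ∷-walk false (hamming-walk p q)

IsDist-QAdj⇒hamming : ∀ {r} {p q : Vec Bool r} {k} → IsDist QAdj p q k → k ≡ hamming p q
IsDist-QAdj⇒hamming {p = p} {q} (w , min) = ≤-antisym (min _ (hamming-walk p q)) (walk⇒hamming≤ w)

DifferOnlyAt-sym : ∀ {r t} {p q : Vec Bool r} → DifferOnlyAt t p q → DifferOnlyAt t q p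
DifferOnlyAt-sym (p≢q , same) = ≢-sym p≢q , λ j j≢t → sym (same j j≢t)

-- Partial cubes

module PartialCubeProperties {n} (G : Graph n) (pc : PartialCube G) where

  r : ℕ
  r = proj₁ pc

  φ : Fin n → Vec Bool r
  φ = proj₁ (proj₂ pc)

  φ-adj : ∀ {x y} → E G x y → QAdj (φ x) (φ y)
  φ-adj = proj₁ (proj₂ (proj₂ (proj₂ pc))) _ _

  Flips : Fin r → Fin n → Fin n → Set
  Flips t x y = lookup (φ x) t ≢ lookup (φ y) t

  Flips-sym : ∀ {t x y} → Flips t x y → Flips t y x
  Flips-sym = ≢-sym

  edge-flip : ∀ {x y} → E G x y → Σ (Fin r) λ t → Flips t x y
  edge-flip e = proj₁ (φ-adj e) , proj₁ (proj₂ (φ-adj e))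

  edge-DifferOnlyAt : ∀ {t x y} → E G x y → Flips t x y → DifferOnlyAt t (φ x) (φ y)
  edge-DifferOnlyAt e = QAdj-DifferOnlyAt (φ-adj e)

  dist≡hamming : ∀ {x y k} → IsDist (E G) x y k → k ≡ hamming (φ x) (φ y)
  dist≡hamming d = IsDist-QAdj⇒hamming (proj₂ (proj₂ (proj₂ (proj₂ pc))) _ _ _ d)

  walk⇒hamming≤ᴳ : ∀ {x y k} → Walk (E G) x y k → hamming (φ x) (φ y) ≤ k
  walk⇒hamming≤ᴳ w = walk⇒hamming≤ (mapʷ φ φ-adj w)

  Θ⇒same-flip : ∀ {x y u v t s} → Theta G x y u v → E G x y → E G u v →
                Flips t x y → Flips s u v → t ≡ s
  Θ⇒same-flip {x} {y} {u} {v} {t} {s} (|xu| , |yv| , |xv| , |yu| , dxu , dyv , dxv , dyu , Θ) exy euv t-flip s-flip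
    with t ≟ᶠ s
  ... | yes t≡s = t≡s
  ... | no t≢s  = ⊥-elim (Θ (begin
    |xu| + |yv|                               ≡⟨ cong₂ _+_ (dist≡hamming dxu) (dist≡hamming dyv) ⟩
    hamming (φ x) (φ u) + hamming (φ y) (φ v) ≡⟨ hamming-swap {p = φ x} {φ y} {φ u} {φ v} agree ⟩
    hamming (φ x) (φ v) + hamming (φ y) (φ u) ≡⟨ cong₂ _+_ (dist≡hamming dxv) (dist≡hamming dyu) ⟨
    |xv| + |yu|                               ∎))
    where
    open ≡-Reasoning
    agree : ∀ j → lookup (φ x) j ≡ lookup (φ y) j ⊎ lookup (φ u) j ≡ lookup (φ v) j
    agree j with j ≟ᶠ t
    ... | yes refl = inj₂ (DifferOnlyAt.agrees (edge-DifferOnlyAt euv s-flip) j t≢s)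
    ... | no j≢t   = inj₁ (DifferOnlyAt.agrees (edge-DifferOnlyAt exy t-flip) j j≢t)

  shortest-walk-flips-once : ∀ {a b k x₁ y₁ x₂ y₂ t} → IsDist (E G) a b k → (w : Walk (E G) a b k) →
                             OnWalk x₁ y₁ w → OnWalk x₂ y₂ w → ¬ SameEdge x₁ y₁ x₂ y₂ →
                             Flips t x₁ y₁ → Flips t x₂ y₂ → ⊥
  shortest-walk-flips-once {a} {b} {k} {t = t} d w o₁ o₂ distinct f₁ f₂ = <-irrefl refl (begin-strict
    k                                   ≡⟨ dist≡hamming d ⟩
    h a b                               ≤⟨ hamming-triangle (φ a) (φ u₁) (φ b) ⟩
    h a u₁ + h u₁ b                     ≤⟨ +-monoʳ-≤ (h a u₁) (hamming-triangle (φ u₁) (φ v₂) (φ b)) ⟩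
    h a u₁ + (h u₁ v₂ + h v₂ b)         ≡⟨ cong (λ m → h a u₁ + (m + h v₂ b)) reflected ⟩
    h a u₁ + (h v₁ u₂ + h v₂ b)         ≤⟨ +-mono-≤ (walk⇒hamming≤ᴳ before)
                                             (+-mono-≤ (walk⇒hamming≤ᴳ between) (walk⇒hamming≤ᴳ after)) ⟩
    k₁ + (k₂ + k₃)                      <⟨ +-monoʳ-< k₁ (s≤s (+-monoʳ-≤ k₂ (n≤1+n k₃))) ⟩
    k₁ + suc (k₂ + suc k₃)              ≡⟨ length ⟨
    k                                   ∎)
    where
    open DoubleSplit (OnWalk-split₂ (λ {x} {y} → Flips-sym {t} {x} {y}) w o₁ o₂ distinct f₁ f₂)
    open ≤-Reasoning
    h : Fin n → Fin n → ℕ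
    h x y = hamming (φ x) (φ y)
    -- Both steps flip t, so moving both ends across them leaves the Hamming distance unchanged.
    reflected : h u₁ v₂ ≡ h v₁ u₂
    reflected = hamming-negate (edge-DifferOnlyAt step₁ F-step₁)
                               (DifferOnlyAt-sym (edge-DifferOnlyAt step₂ F-step₂))

-- Reachability and simple paths

module Reachability {n} (G : Graph n) where

  E-sym : ∀ {x y} → E G x y → E G y x
  E-sym {x} {y} = trans (Graph.sym G y x)

  Reachable : (Fin n → Set) → Fin n → Fin n → Set
  Reachable P x y = Σ ℕ λ k → Walk (λ a b → E G a b × P a × P b) x y k

  module _ {P : Fin n → Set} where

    reachable-refl : ∀ {x} → Reachable P x x
    reachable-refl = 0 , []

    reachable-trans : ∀ {x y z} → Reachable P x y → Reachable P y z → Reachable P x z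
    reachable-trans (k , w) (m , v) = k + m , w ++ʷ v

    reachable-sym : ∀ {x y} → Reachable P x y → Reachable P y x
    reachable-sym (k , w) = k , reverseʷ (λ (e , p , q) → E-sym e , q , p) w

    reachable-edge : ∀ {x y} → E G x y → P x → P y → Reachable P x y
    reachable-edge e p q = 1 , (e , p , q) ∷ []

    reachable-target : ∀ {x y} → P x → Reachable P x y → P y
    reachable-target p (_ , [])              = p
    reachable-target _ (_ , (_ , _ , q) ∷ w) = reachable-target q (_ , w)

    connectedOn-hub : ∀ h → (∀ x → P x → Reachable P x h) → ConnectedOn G P
    connectedOn-hub h to-h x y px py = reachable-trans (to-h x px) (reachable-sym (to-h y py))

  reachable-mono : ∀ {P Q : Fin n → Set} → (∀ {x} → P x → Q x) →
                   ∀ {x y} → Reachable P x y → Reachable Q x y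
  reachable-mono P⇒Q (k , w) = k , mapʷ id (λ (e , p , q) → e , P⇒Q p , P⇒Q q) w

module SimplePaths {n} (G : Graph n) where
  open Reachability G

  infixr 5 _∷ᵖ_
  infix 4 _∈ᵖ_

  data Path : Fin n → Fin n → Set where
    [_]ᵖ : ∀ x → Path x x
    _∷ᵖ_ : ∀ {x y z} → E G x y → Path y z → Path x z

  _∈ᵖ_ : ∀ {x y} → Fin n → Path x y → Set
  u ∈ᵖ [ x ]ᵖ = u ≡ x
  _∈ᵖ_ {x} u (_ ∷ᵖ p) = u ≡ x ⊎ u ∈ᵖ p

  _∈ᵖ?_ : ∀ {x y} u (p : Path x y) → Dec (u ∈ᵖ p)
  u ∈ᵖ? [ x ]ᵖ = u ≟ᶠ x
  _∈ᵖ?_ {x} u (_ ∷ᵖ p) with u ≟ᶠ x | u ∈ᵖ? p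
  ... | yes u≡x | _         = yes (inj₁ u≡x)
  ... | no _    | yes u∈p   = yes (inj₂ u∈p)
  ... | no u≢x  | no u∉p    = no λ { (inj₁ u≡x) → u≢x u≡x ; (inj₂ u∈p) → u∉p u∈p }

  start∈ᵖ : ∀ {x y} (p : Path x y) → x ∈ᵖ p
  start∈ᵖ [ x ]ᵖ   = refl
  start∈ᵖ (_ ∷ᵖ p) = inj₁ refl

  end∈ᵖ : ∀ {x y} (p : Path x y) → y ∈ᵖ p
  end∈ᵖ [ x ]ᵖ   = refl
  end∈ᵖ (_ ∷ᵖ p) = inj₂ (end∈ᵖ p)

  Simple : ∀ {x y} → Path x y → Set
  Simple [ x ]ᵖ        = ⊤
  Simple {x} (_ ∷ᵖ p) = ¬ (x ∈ᵖ p) × Simple p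

  Allᵖ : (Fin n → Set) → ∀ {x y} → Path x y → Set
  Allᵖ Q p = ∀ u → u ∈ᵖ p → Q u

  _⊆ᵖ_ : ∀ {x y x′ y′} → Path x y → Path x′ y′ → Set
  q ⊆ᵖ p = ∀ u → u ∈ᵖ q → u ∈ᵖ p

  record SimpleSubpath (x y : Fin n) {x′ y′} (p : Path x′ y′) : Set where
    constructor simpleSubpath
    field
      path   : Path x y
      simple : Simple path
      ⊆p     : path ⊆ᵖ p

  suffixFrom : ∀ {x u y} (q : Path u y) → x ∈ᵖ q → Simple q → SimpleSubpath x y q
  suffixFrom [ u ]ᵖ   refl       _ = simpleSubpath [ u ]ᵖ tt (λ _ m → m)
  suffixFrom (e ∷ᵖ q) (inj₁ refl) s = simpleSubpath (e ∷ᵖ q) s (λ _ m → m)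
  suffixFrom (e ∷ᵖ q) (inj₂ x∈q) (_ , s) with suffixFrom q x∈q s
  ... | simpleSubpath q′ s′ q′⊆q = simpleSubpath q′ s′ (λ u m → inj₂ (q′⊆q u m))

  simplify : ∀ {x y} (p : Path x y) → SimpleSubpath x y p
  simplify [ x ]ᵖ = simpleSubpath [ x ]ᵖ tt (λ _ m → m)
  simplify {x} (e ∷ᵖ p) with simplify p
  ... | simpleSubpath q s q⊆p with x ∈ᵖ? q
  ...   | yes x∈q = let simpleSubpath q′ s′ q′⊆q = suffixFrom q x∈q s
                    in simpleSubpath q′ s′ (λ u m → inj₂ (q⊆p u (q′⊆q u m)))
  ...   | no x∉q  = simpleSubpath (e ∷ᵖ q) (x∉q , s)
                      λ { u (inj₁ u≡x) → inj₁ u≡x ; u (inj₂ m) → inj₂ (q⊆p u m) }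

  walk⇒path : ∀ {d x y k} → Walk (λ a b → E G a b × a ≢ d × b ≢ d) x y k → x ≢ d →
              Σ (Path x y) (Allᵖ (_≢ d))
  walk⇒path [] x≢d = [ _ ]ᵖ , λ { u refl → x≢d }
  walk⇒path ((e , x≢d , y≢d) ∷ w) _ with walk⇒path w y≢d
  ... | p , avoids = e ∷ᵖ p , λ { u (inj₁ refl) → x≢d ; u (inj₂ m) → avoids u m }

  record EntryInto (S : Subset n) {x y} (q : Path x y) : Set where
    field
      {last entry}    : Fin n
      prefix          : Path x last
      prefix-simple   : Simple prefix
      prefix-outside  : Allᵖ (_∉ S) prefix
      prefix⊆q        : prefix ⊆ᵖ q
      step            : E G last entry
      entry∈S         : entry ∈ S
      entry∈q         : entry ∈ᵖ q

  firstEntry : ∀ (S : Subset n) {x y} (q : Path x y) → x ∉ S → y ∈ S → Simple q → EntryInto S q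
  firstEntry S [ x ]ᵖ x∉S x∈S _ = ⊥-elim (x∉S x∈S)
  firstEntry S {x} (_∷ᵖ_ {y = x′} e q) x∉S y∈S (x∉q , q-simple) with x′ ∈? S
  ... | yes x′∈S = record
    { prefix = [ x ]ᵖ ; prefix-simple = tt ; prefix-outside = λ { u refl → x∉S }
    ; prefix⊆q = λ { u refl → inj₁ refl } ; step = e ; entry∈S = x′∈S ; entry∈q = inj₂ (start∈ᵖ q) }
  ... | no x′∉S = record
    { prefix = e ∷ᵖ prefix ; prefix-simple = (λ m → x∉q (prefix⊆q x m)) , prefix-simple
    ; prefix-outside = λ { u (inj₁ refl) → x∉S ; u (inj₂ m) → prefix-outside u m }
    ; prefix⊆q = λ { u (inj₁ u≡x) → inj₁ u≡x ; u (inj₂ m) → inj₂ (prefix⊆q u m) }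
    ; step = step ; entry∈S = entry∈S ; entry∈q = inj₂ entry∈q }
    where open EntryInto (firstEntry S q x′∉S y∈S q-simple)

  reachable-toEnd : ∀ {Q x y} (p : Path x y) → Allᵖ Q p → ∀ u → u ∈ᵖ p → Reachable Q u y
  reachable-toEnd [ x ]ᵖ _ u refl = reachable-refl
  reachable-toEnd (_∷ᵖ_ {y = y} e p) all u (inj₁ refl) =
    reachable-trans (reachable-edge e (all u (inj₁ refl)) (all y (inj₂ (start∈ᵖ p))))
                    (reachable-toEnd p (λ v → all v ∘ inj₂) y (start∈ᵖ p))
  reachable-toEnd (e ∷ᵖ p) all u (inj₂ m) = reachable-toEnd p (λ v → all v ∘ inj₂) u m

  reachable-toStart : ∀ {Q x y} (p : Path x y) → Allᵖ Q p → ∀ u → u ∈ᵖ p → Reachable Q u x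
  reachable-toStart [ x ]ᵖ _ u refl = reachable-refl
  reachable-toStart (e ∷ᵖ p) _ u (inj₁ refl) = reachable-refl
  reachable-toStart {x = x} (_∷ᵖ_ {y = y} e p) all u (inj₂ m) =
    reachable-trans (reachable-toStart p (λ v → all v ∘ inj₂) u m)
                    (reachable-edge (E-sym e) (all y (inj₂ (start∈ᵖ p))) (all x (inj₁ refl)))

  -- Needs simplicity: a vertex visited on both sides of v would be cut off from both ends.
  reachable-avoiding-toAnEnd : ∀ {Q x y} (p : Path x y) → Simple p → Allᵖ Q p → ∀ v u → u ∈ᵖ p → u ≢ v →
                               Reachable (λ z → Q z × z ≢ v) u x ⊎ Reachable (λ z → Q z × z ≢ v) u y
  reachable-avoiding-toAnEnd [ x ]ᵖ _ _ v u refl _ = inj₁ reachable-refl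
  reachable-avoiding-toAnEnd (e ∷ᵖ p) _ _ v u (inj₁ refl) _ = inj₁ reachable-refl
  reachable-avoiding-toAnEnd {x = x} (e ∷ᵖ p) (x∉p , p-simple) all v u (inj₂ m) u≢v
    with reachable-avoiding-toAnEnd p p-simple (λ w → all w ∘ inj₂) v u m u≢v
  ... | inj₂ u⇝y = inj₂ u⇝y
  ... | inj₁ u⇝p₀ with x ≟ᶠ v
  ...   | yes refl = inj₂ (reachable-toEnd p (λ w m′ → all w (inj₂ m′) , λ { refl → x∉p m′ }) u m)
  ...   | no x≢v   = inj₁ (reachable-trans u⇝p₀
                            (reachable-edge (E-sym e) (reachable-target (all u (inj₂ m) , u≢v) u⇝p₀)
                                            (all x (inj₁ refl) , x≢v)))

  vertexSet : ∀ {x y} → Path x y → Subset n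
  vertexSet [ x ]ᵖ       = ⁅ x ⁆
  vertexSet {x} (_ ∷ᵖ p) = ⁅ x ⁆ ∪ vertexSet p

  ∈ᵖ⇒∈vertexSet : ∀ {x y} (p : Path x y) {u} → u ∈ᵖ p → u ∈ vertexSet p
  ∈ᵖ⇒∈vertexSet [ x ]ᵖ   refl        = x∈⁅x⁆ x
  ∈ᵖ⇒∈vertexSet (_ ∷ᵖ p) (inj₁ refl) = x∈p∪q⁺ (inj₁ (x∈⁅x⁆ _))
  ∈ᵖ⇒∈vertexSet (_ ∷ᵖ p) (inj₂ m)    = x∈p∪q⁺ (inj₂ (∈ᵖ⇒∈vertexSet p m))

  ∈vertexSet⇒∈ᵖ : ∀ {x y} (p : Path x y) {u} → u ∈ vertexSet p → u ∈ᵖ p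
  ∈vertexSet⇒∈ᵖ [ x ]ᵖ m = x∈⁅y⁆⇒x≡y x m
  ∈vertexSet⇒∈ᵖ {x} (_ ∷ᵖ p) m with x∈p∪q⁻ ⁅ x ⁆ (vertexSet p) m
  ... | inj₁ m′ = inj₁ (x∈⁅y⁆⇒x≡y x m′)
  ... | inj₂ m′ = inj₂ (∈vertexSet⇒∈ᵖ p m′)

-- Blocks

module Ear {n} (G : Graph n) {S : Subset n} (S-2conn : TwoConnected G S)
           {d z p₀ w : Fin n} (P : SimplePaths.Path G z p₀) (P-simple : SimplePaths.Simple G P)
           (P-outside : SimplePaths.Allᵖ G (_∉ S) P)
           (d∈S : d ∈ S) (w∈S : w ∈ S) (w≢d : w ≢ d) (dz : E G d z) (p₀w : E G p₀ w) where
  open Reachability G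
  open SimplePaths G

  T : Subset n
  T = S ∪ vertexSet P

  S⊆T : S ⊆ T
  S⊆T m = x∈p∪q⁺ (inj₁ m)

  P⊆T : ∀ {u} → u ∈ᵖ P → u ∈ T
  P⊆T m = x∈p∪q⁺ (inj₂ (∈ᵖ⇒∈vertexSet P m))

  T-cases : ∀ {u} → u ∈ T → u ∈ S ⊎ u ∈ᵖ P
  T-cases m with x∈p∪q⁻ S (vertexSet P) m
  ... | inj₁ u∈S = inj₁ u∈S
  ... | inj₂ u∈V = inj₂ (∈vertexSet⇒∈ᵖ P u∈V)

  S-connected : ConnectedOn G (_∈ S)
  S-connected = proj₁ (proj₂ S-2conn)

  S-connected-avoiding : ∀ v → v ∈ S → ConnectedOn G (λ x → x ∈ S × x ≢ v)
  S-connected-avoiding = proj₂ (proj₂ S-2conn)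

  Avoiding : Fin n → Fin n → Set
  Avoiding v x = x ∈ T × x ≢ v

  ear-connected : ConnectedOn G (_∈ T)
  ear-connected = connectedOn-hub d λ x x∈T → to-d x (T-cases x∈T)
    where
    to-d : ∀ x → x ∈ S ⊎ x ∈ᵖ P → Reachable (_∈ T) x d
    to-d x (inj₁ x∈S) = reachable-mono S⊆T (S-connected x d x∈S d∈S)
    to-d x (inj₂ x∈P) = reachable-trans (reachable-toStart P (λ _ → P⊆T) x x∈P)
                                        (reachable-edge (E-sym dz) (P⊆T (start∈ᵖ P)) (S⊆T d∈S))

  P-avoids-S : ∀ {v} → v ∈ S → Allᵖ (Avoiding v) P
  P-avoids-S v∈S u m = P⊆T m , λ { refl → P-outside u m v∈S }

  -- Removing v ∈ S, the ear stays attached to S through whichever of its two feet d, w is not v.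
  ear-connected-avoiding-S : ∀ v → v ∈ S → ConnectedOn G (Avoiding v)
  ear-connected-avoiding-S v v∈S with d ≟ᶠ v
  ... | no d≢v = connectedOn-hub d λ x (x∈T , x≢v) → to-d x x≢v (T-cases x∈T)
    where
    to-d : ∀ x → x ≢ v → x ∈ S ⊎ x ∈ᵖ P → Reachable (Avoiding v) x d
    to-d x x≢v (inj₁ x∈S) = reachable-mono (λ (m , ≢v) → S⊆T m , ≢v)
                                           (S-connected-avoiding v v∈S x d (x∈S , x≢v) (d∈S , d≢v))
    to-d x x≢v (inj₂ x∈P) = reachable-trans (reachable-toStart P (P-avoids-S v∈S) x x∈P)
                              (reachable-edge (E-sym dz) (P-avoids-S v∈S z (start∈ᵖ P)) (S⊆T d∈S , d≢v))
  ... | yes refl = connectedOn-hub w λ x (x∈T , x≢v) → to-w x x≢v (T-cases x∈T)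
    where
    to-w : ∀ x → x ≢ d → x ∈ S ⊎ x ∈ᵖ P → Reachable (Avoiding d) x w
    to-w x x≢d (inj₁ x∈S) = reachable-mono (λ (m , ≢d) → S⊆T m , ≢d)
                                           (S-connected-avoiding d v∈S x w (x∈S , x≢d) (w∈S , w≢d))
    to-w x x≢d (inj₂ x∈P) = reachable-trans (reachable-toEnd P (P-avoids-S v∈S) x x∈P)
                              (reachable-edge p₀w (P-avoids-S v∈S p₀ (end∈ᵖ P)) (S⊆T w∈S , w≢d))

  ear-connected-avoiding-P : ∀ v → v ∈ᵖ P → ConnectedOn G (Avoiding v)
  ear-connected-avoiding-P v v∈P = connectedOn-hub d λ x (x∈T , x≢v) → to-d x x≢v (T-cases x∈T)
    where
    v∉S : v ∉ S
    v∉S = P-outside v v∈P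
    S-avoids : ∀ {x} → x ∈ S → Avoiding v x
    S-avoids x∈S = S⊆T x∈S , λ { refl → v∉S x∈S }
    to-d : ∀ x → x ≢ v → x ∈ S ⊎ x ∈ᵖ P → Reachable (Avoiding v) x d
    to-d x x≢v (inj₁ x∈S) = reachable-mono S-avoids (S-connected x d x∈S d∈S)
    to-d x x≢v (inj₂ x∈P) with reachable-avoiding-toAnEnd P P-simple (λ _ → P⊆T) v x x∈P x≢v
    ... | inj₁ x⇝z  = reachable-trans x⇝z
                        (reachable-edge (E-sym dz) (reachable-target (P⊆T x∈P , x≢v) x⇝z) (S-avoids d∈S))
    ... | inj₂ x⇝p₀ = reachable-trans x⇝p₀ (reachable-trans
                        (reachable-edge p₀w (reachable-target (P⊆T x∈P , x≢v) x⇝p₀) (S-avoids w∈S))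
                        (reachable-mono S-avoids (S-connected w d w∈S d∈S)))

  ear-twoConnected : TwoConnected G T
  ear-twoConnected =
    ≤-trans (proj₁ S-2conn) (p⊆q⇒∣p∣≤∣q∣ S⊆T) , ear-connected , λ v v∈T → avoiding v (T-cases v∈T)
    where
    avoiding : ∀ v → v ∈ S ⊎ v ∈ᵖ P → ConnectedOn G (Avoiding v)
    avoiding v (inj₁ v∈S) = ear-connected-avoiding-S v v∈S
    avoiding v (inj₂ v∈P) = ear-connected-avoiding-P v v∈P

module Blocks {n} (G : Graph n) where
  open Reachability G
  open SimplePaths G

  maximalTwoConnected-noDetour : ∀ {S d z c} → MaximalTwoConnected G S → d ∈ S → c ∈ S → z ∉ S →
                                 E G d z → Reachable (_≢ d) z c → ⊥
  maximalTwoConnected-noDetour {S} {d} {z} {c} (S-2conn , S-maximal) d∈S c∈S z∉S dz (_ , z⇝c) =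
    z∉S (subst (z ∈_) T≡S (P⊆T (start∈ᵖ prefix)))
    where
    z≢d : z ≢ d
    z≢d refl = z∉S d∈S
    detour : Σ (Path z c) (Allᵖ (_≢ d))
    detour = walk⇒path z⇝c z≢d
    open SimpleSubpath (simplify (proj₁ detour))
    open EntryInto (firstEntry S path z∉S c∈S simple)
    open Ear G S-2conn prefix prefix-simple prefix-outside d∈S entry∈S
             (proj₂ detour _ (⊆p _ entry∈q)) dz step
    T≡S : T ≡ S
    T≡S = S-maximal T S⊆T ear-twoConnected

  bridge-sym : ∀ {x y} → Bridge G x y → Bridge G y x
  bridge-sym {x} {y} (xy , no-detour) =
    E-sym xy , λ (k , y⇝x) →
      no-detour (k , reverseʷ R-sym (mapʷ id (λ (e , ≠yx) → e , ≠yx ∘ Sum.swap) y⇝x))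
    where
    R-sym : ∀ {a b} → E G a b × ¬ SameEdge a b x y → E G b a × ¬ SameEdge b a x y
    R-sym (e , ≠xy) = E-sym e , ≠xy ∘ SameEdge-swapˡ

  bridge-noDetour : ∀ {x y z} → Bridge G x y → E G x z → z ≢ x → z ≢ y → Reachable (_≢ x) z y → ⊥
  bridge-noDetour {x} {y} {z} (_ , no-detour) xz z≢x z≢y (k , z⇝y) =
    no-detour (suc k , (xz , xz≠xy) ∷ mapʷ id (λ (e , a≢x , b≢x) → e , avoids-x a≢x b≢x) z⇝y)
    where
    xz≠xy : ¬ SameEdge x z x y
    xz≠xy (inj₁ (_ , z≡y)) = z≢y z≡y
    xz≠xy (inj₂ (_ , z≡x)) = z≢x z≡x
    avoids-x : ∀ {a b} → a ≢ x → b ≢ x → ¬ SameEdge a b x y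
    avoids-x a≢x _ (inj₁ (a≡x , _)) = a≢x a≡x
    avoids-x _ b≢x (inj₂ (_ , b≡x)) = b≢x b≡x

  block-noDetour : ∀ {S d z c} → IsBlock G S → d ∈ S → c ∈ S → d ≢ c → z ∉ S →
                   E G d z → Reachable (_≢ d) z c → ⊥
  block-noDetour (inj₁ maximal) d∈S c∈S _ z∉S = maximalTwoConnected-noDetour maximal d∈S c∈S z∉S
  block-noDetour {S} {d} {z} {c} (inj₂ (x , y , bridge , members)) d∈S c∈S d≢c z∉S dz detour =
    ends (proj₁ (members d) d∈S) (proj₁ (members c) c∈S)
    where
    z≢x : z ≢ x
    z≢x refl = z∉S (proj₂ (members x) (inj₁ refl))
    z≢y : z ≢ y
    z≢y refl = z∉S (proj₂ (members y) (inj₂ refl))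
    ends : d ≡ x ⊎ d ≡ y → c ≡ x ⊎ c ≡ y → ⊥
    ends (inj₁ refl) (inj₁ refl) = d≢c refl
    ends (inj₂ refl) (inj₂ refl) = d≢c refl
    ends (inj₁ refl) (inj₂ refl) = bridge-noDetour bridge dz z≢x z≢y detour
    ends (inj₂ refl) (inj₁ refl) = bridge-noDetour (bridge-sym bridge) dz z≢y z≢x detour

  cutOf : ∀ {S} → IsEndBlock G S → Fin n
  cutOf eb = proj₁ (proj₂ eb)

  cut∈endBlock : ∀ {S} (eb : IsEndBlock G S) → cutOf eb ∈ S
  cut∈endBlock eb = proj₁ (proj₁ (proj₂ (proj₂ eb)))

  -- A neighbour z ∉ S of d would make d a second cut vertex: a detour from z to c avoiding d
  -- would enlarge the block by an ear, or bypass the bridge.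
  endBlock-closed : ∀ {S} (eb : IsEndBlock G S) {d z} → d ∈ S → d ≢ cutOf eb → E G d z → z ∈ S
  endBlock-closed {S} (block , c , (c∈S , _) , only-cut) {d} {z} d∈S d≢c dz =
    decidable-stable (z ∈? S) λ z∉S →
      d≢c (only-cut d d∈S (z , c , (λ { refl → z∉S d∈S }) , ≢-sym d≢c ,
                           block-noDetour block d∈S c∈S d≢c z∉S dz))

  endBlock-closed-reachable : ∀ {S} (eb : IsEndBlock G S) {Q : Fin n → Set} → (∀ {u} → Q u → u ≢ cutOf eb) →
                              ∀ {x y} → x ∈ S → Reachable Q x y → y ∈ S
  endBlock-closed-reachable eb Q≢c x∈S (_ , [])               = x∈S
  endBlock-closed-reachable eb Q≢c x∈S (_ , (e , qx , _) ∷ w) =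
    endBlock-closed-reachable eb Q≢c (endBlock-closed eb x∈S (Q≢c qx) e) (_ , w)

  block-connected-avoiding : ∀ {T} → IsBlock G T → ∀ v → ConnectedOn G (λ x → x ∈ T × x ≢ v)
  block-connected-avoiding {T} (inj₁ ((_ , T-connected , T-connected-avoiding) , _))
                           v x y (x∈T , x≢v) (y∈T , y≢v) with v ∈? T
  ... | yes v∈T = T-connected-avoiding v v∈T x y (x∈T , x≢v) (y∈T , y≢v)
  ... | no v∉T  = reachable-mono (λ {u} u∈T → u∈T , λ { refl → v∉T u∈T }) (T-connected x y x∈T y∈T)
  block-connected-avoiding {T} (inj₂ (p , q , (pq , _) , members))
                           v x y (x∈T , x≢v) (y∈T , y≢v) with x ≟ᶠ y
  ... | yes refl = reachable-refl
  ... | no x≢y   = ends (proj₁ (members x) x∈T) (proj₁ (members y) y∈T)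
    where
    ends : x ≡ p ⊎ x ≡ q → y ≡ p ⊎ y ≡ q → Reachable (λ u → u ∈ T × u ≢ v) x y
    ends (inj₁ refl) (inj₁ refl) = ⊥-elim (x≢y refl)
    ends (inj₂ refl) (inj₂ refl) = ⊥-elim (x≢y refl)
    ends (inj₁ refl) (inj₂ refl) = reachable-edge pq (x∈T , x≢v) (y∈T , y≢v)
    ends (inj₂ refl) (inj₁ refl) = reachable-edge (E-sym pq) (x∈T , x≢v) (y∈T , y≢v)

  endBlock-⊇-block : ∀ {S T} (eb : IsEndBlock G S) → IsBlock G T →
                     ∀ {x} → x ∈ S → x ≢ cutOf eb → x ∈ T → T ⊆ S
  endBlock-⊇-block eb T-block {x} x∈S x≢c x∈T {y} y∈T with y ≟ᶠ cutOf eb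
  ... | yes refl = cut∈endBlock eb
  ... | no y≢c   = endBlock-closed-reachable eb proj₂ x∈S
                     (block-connected-avoiding T-block (cutOf eb) x y (x∈T , x≢c) (y∈T , y≢c))

  endBlocks-≡ : ∀ {S T} (ebS : IsEndBlock G S) (ebT : IsEndBlock G T) →
                ∀ {x} → x ∈ S → x ≢ cutOf ebS → x ∈ T → x ≢ cutOf ebT → S ≡ T
  endBlocks-≡ ebS ebT x∈S x≢cS x∈T x≢cT =
    ⊆-antisym (endBlock-⊇-block ebT (proj₁ ebS) x∈T x≢cT x∈S)
              (endBlock-⊇-block ebS (proj₁ ebT) x∈S x≢cS x∈T)

-- The interior of an end block

module Interior {n} (G : Graph n) (S : Subset n) (c : Fin n)
                (closed : ∀ {d z} → d ∈ S → d ≢ c → E G d z → z ∈ S) where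
  open Reachability G using (E-sym)

  Inner : Fin n → Set
  Inner x = x ∈ S × x ≢ c

  inner? : ∀ x → Dec (Inner x)
  inner? x with x ∈? S | x ≟ᶠ c
  ... | yes x∈S | no x≢c  = yes (x∈S , x≢c)
  ... | yes _   | yes x≡c = no λ (_ , x≢c) → x≢c x≡c
  ... | no x∉S  | _       = no λ (x∈S , _) → x∉S x∈S

  record ThroughCut (x u : Fin n) (k : ℕ) : Set where
    constructor via
    field
      {k₁ k₂} : ℕ
      toCut   : Walk (E G) x c k₁
      fromCut : Walk (E G) c u k₂
      length  : k ≡ k₁ + k₂

  walk-throughCut : ∀ {x u k} → Walk (E G) x u k → ¬ Inner x → u ∈ S → ThroughCut x u k
  walk-throughCut {x} w ¬inner u∈S with x ≟ᶠ c
  ... | yes refl = via [] w refl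
  walk-throughCut [] ¬inner u∈S | no x≢c = ⊥-elim (¬inner (u∈S , x≢c))
  walk-throughCut (e ∷ w) ¬inner u∈S | no x≢c = via (e ∷ toCut) fromCut (cong suc length)
    where
    ¬inner′ : ¬ Inner _
    ¬inner′ (x′∈S , x′≢c) = ¬inner (closed x′∈S x′≢c (E-sym e) , x≢c)
    open ThroughCut (walk-throughCut w ¬inner′ u∈S)

  dist-throughCut : ∀ {x u k} → IsDist (E G) x u k → ¬ Inner x → u ∈ S →
                    Σ ℕ λ k₁ → Σ ℕ λ k₂ → IsDist (E G) x c k₁ × IsDist (E G) c u k₂ × k ≡ k₁ + k₂
  dist-throughCut d ¬inner u∈S with walk-throughCut (proj₁ d) ¬inner u∈S
  ... | via toCut fromCut length with IsDist-split d toCut fromCut length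
  ...   | d₁ , d₂ = _ , _ , d₁ , d₂ , length

  Θ⇒touches-interior : ∀ {x y u v} → Theta G x y u v → u ∈ S → v ∈ S → Inner x ⊎ Inner y
  Θ⇒touches-interior {x} {y} (_ , _ , _ , _ , dxu , dyv , dxv , dyu , Θ) u∈S v∈S
    with inner? x | inner? y
  ... | yes inner-x | _ = inj₁ inner-x
  ... | no _ | yes inner-y = inj₂ inner-y
  ... | no ¬x | no ¬y
    with dist-throughCut dxu ¬x u∈S | dist-throughCut dyv ¬y v∈S
       | dist-throughCut dxv ¬x v∈S | dist-throughCut dyu ¬y u∈S
  ... | |xc| , |cu| , dxc , dcu , refl | |yc| , |cv| , dyc , dcv , refl
      | _ , _ , dxc′ , dcv′ , refl | _ , _ , dyc′ , dcu′ , refl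
    with IsDist-unique dxc dxc′ | IsDist-unique dyc dyc′ | IsDist-unique dcu dcu′ | IsDist-unique dcv dcv′
  ... | refl | refl | refl | refl = ⊥-elim (Θ (swap-middle |xc| |cu| |yc| |cv|))
    where
    swap-middle : ∀ a b c d → (a + b) + (c + d) ≡ (a + d) + (c + b)
    swap-middle = solve-∀

  -- A shortest walk entering the interior would have to leave it again through c, and could skip the visit.
  shortest-avoids-interior : ∀ {a b u k l₁ l₂} → IsDist (E G) a b k → Walk (E G) a u l₁ → Walk (E G) u b l₂ →
                             k ≡ l₁ + l₂ → ¬ Inner a → ¬ Inner b → ¬ Inner u
  shortest-avoids-interior (_ , minimal) a⇝u u⇝b k≡ ¬a ¬b (u∈S , u≢c)
    with walk-throughCut a⇝u ¬a u∈S | walk-throughCut (reverseʷ E-sym u⇝b) ¬b u∈S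
  ... | via _ [] _ | _ = u≢c refl
  ... | via {m₁} {suc m₂} a⇝c _ refl | via {m₃} {m₄} b⇝c _ refl =
    <-irrefl refl (begin-strict
      m₁ + m₃                              <⟨ s≤s (m≤m+n (m₁ + m₃) (m₂ + m₄)) ⟩
      suc ((m₁ + m₃) + (m₂ + m₄))          ≡⟨ regroup m₁ m₂ m₃ m₄ ⟩
      (m₁ + suc m₂) + (m₃ + m₄)            ≡⟨ k≡ ⟨
      _                                    ≤⟨ minimal _ (a⇝c ++ʷ reverseʷ E-sym b⇝c) ⟩
      m₁ + m₃                              ∎)
    where
    open ≤-Reasoning
    regroup : ∀ a b c d → suc ((a + c) + (b + d)) ≡ (a + suc b) + (c + d)
    regroup = solve-∀

  shortest-walk-touching-interior : ∀ {a b k x y} → IsDist (E G) a b k → (w : Walk (E G) a b k) →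
                                    OnWalk x y w → Inner x ⊎ Inner y → Inner a ⊎ Inner b
  shortest-walk-touching-interior {a} {b} d w on touches with inner? a | inner? b
  ... | yes inner-a | _ = inj₁ inner-a
  ... | no _ | yes inner-b = inj₂ inner-b
  ... | no ¬a | no ¬b = ⊥-elim (at-step F-step)
    where
    open Split (OnWalk-split Sum.swap on touches)
    at-step : Inner u ⊎ Inner v → ⊥
    at-step (inj₁ inner-u) = shortest-avoids-interior d before (step ∷ after) length ¬a ¬b inner-u
    at-step (inj₂ inner-v) = shortest-avoids-interior d (before ++ʷ step ∷ []) after
                               (trans length (sym (+-assoc k₁ 1 k₂))) ¬a ¬b inner-v

pigeonhole-⊎ : ∀ {A : Set} {P₁ P₂ P₃ : A → Set} {a b : A} →
               P₁ a ⊎ P₁ b → P₂ a ⊎ P₂ b → P₃ a ⊎ P₃ b →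
               (∀ {z} → P₁ z → P₂ z → ⊥) → (∀ {z} → P₁ z → P₃ z → ⊥) →
               (∀ {z} → P₂ z → P₃ z → ⊥) → ⊥
pigeonhole-⊎ (inj₁ p) (inj₁ q) _ ⊥₁₂ _ _ = ⊥₁₂ p q
pigeonhole-⊎ (inj₂ p) (inj₂ q) _ ⊥₁₂ _ _ = ⊥₁₂ p q
pigeonhole-⊎ (inj₁ p) _ (inj₁ q) _ ⊥₁₃ _ = ⊥₁₃ p q
pigeonhole-⊎ (inj₂ p) _ (inj₂ q) _ ⊥₁₃ _ = ⊥₁₃ p q
pigeonhole-⊎ _ (inj₁ p) (inj₁ q) _ _ ⊥₂₃ = ⊥₂₃ p q
pigeonhole-⊎ _ (inj₂ p) (inj₂ q) _ _ ⊥₂₃ = ⊥₂₃ p q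


module ChosenClasses {n} (G : Graph n) (pc : PartialCube G) {k} (B : Fin k → Subset n)
                    (endBlock : ∀ i → IsEndBlock G (B i)) (B-injective : ∀ i j → B i ≡ B j → i ≡ j)
                    (a b : Fin k → Fin n) (ab∈B : ∀ i → E G (a i) (b i) × a i ∈ B i × b i ∈ B i) where
  open PartialCubeProperties G pc
  open Blocks G
  module I (i : Fin k) = Interior G (B i) (cutOf (endBlock i)) (endBlock-closed (endBlock i))

  InClass : Fin k → Fin n → Fin n → Set
  InClass i x y = E G x y × Theta G x y (a i) (b i)

  coordinate : Fin k → Fin r
  coordinate i = proj₁ (edge-flip (proj₁ (ab∈B i)))

  class-flips : ∀ {i x y} → InClass i x y → Flips (coordinate i) x y
  class-flips {i} (xy , θ) with edge-flip xy
  ... | t , t-flip = subst (λ s → Flips s _ _) t≡coordinate t-flip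
    where
    t≡coordinate : t ≡ coordinate i
    t≡coordinate = Θ⇒same-flip θ xy (proj₁ (ab∈B i)) t-flip (proj₂ (edge-flip _))

  module _ {a′ b′ l} (w : Walk (E G) a′ b′ l) (shortest : IsDist (E G) a′ b′ l) where

    end-inner : ∀ {i x y} → OnWalk x y w → InClass i x y → I.Inner i a′ ⊎ I.Inner i b′
    end-inner {i} on (_ , θ) = I.shortest-walk-touching-interior i shortest w on
      (I.Θ⇒touches-interior i θ (proj₁ (proj₂ (ab∈B i))) (proj₂ (proj₂ (ab∈B i))))

    classes-apart : ∀ {i j x₁ y₁ x₂ y₂} → OnWalk x₁ y₁ w → OnWalk x₂ y₂ w → ¬ SameEdge x₁ y₁ x₂ y₂ →
                    InClass i x₁ y₁ → InClass j x₂ y₂ → ∀ {z} → I.Inner i z → I.Inner j z → ⊥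
    classes-apart {i} {j} on₁ on₂ distinct e₁ e₂ (z∈Bi , z≢cᵢ) (z∈Bj , z≢cⱼ)
      with B-injective i j (endBlocks-≡ (endBlock i) (endBlock j) z∈Bi z≢cᵢ z∈Bj z≢cⱼ)
    ... | refl = shortest-walk-flips-once shortest w on₁ on₂ distinct (class-flips e₁) (class-flips e₂)

    no-three-on-shortest-walk : ∀ {i₁ i₂ i₃ x₁ y₁ x₂ y₂ x₃ y₃} →
      InClass i₁ x₁ y₁ → InClass i₂ x₂ y₂ → InClass i₃ x₃ y₃ →
      OnWalk x₁ y₁ w → OnWalk x₂ y₂ w → OnWalk x₃ y₃ w →
      ¬ SameEdge x₁ y₁ x₂ y₂ → ¬ SameEdge x₁ y₁ x₃ y₃ → ¬ SameEdge x₂ y₂ x₃ y₃ → ⊥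
    no-three-on-shortest-walk {i₁} {i₂} {i₃} e₁ e₂ e₃ on₁ on₂ on₃ ≠₁₂ ≠₁₃ ≠₂₃ =
      pigeonhole-⊎ {P₁ = I.Inner i₁} {I.Inner i₂} {I.Inner i₃}
        (end-inner on₁ e₁) (end-inner on₂ e₂) (end-inner on₃ e₃)
        (classes-apart on₁ on₂ ≠₁₂ e₁ e₂) (classes-apart on₁ on₃ ≠₁₃ e₁ e₃)
        (classes-apart on₂ on₃ ≠₂₃ e₂ e₃)

proposition3p3 : ∀ {n} (G : Graph n) → Connected G → PartialCube G →
    (k : ℕ) (B : Fin k → Subset n) →
    (∀ i → IsEndBlock G (B i)) →
    (∀ i j → B i ≡ B j → i ≡ j) →
    (∀ S → IsEndBlock G S → Σ (Fin k) λ i → B i ≡ S) →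
    (a b : Fin k → Fin n) →
    (∀ i → E G (a i) (b i) × a i ∈ B i × b i ∈ B i) →
    EdgeGP G (λ x y → E G x y × Σ (Fin k) λ i → Theta G x y (a i) (b i))
proposition3p3 G _ pc k B endBlock B-injective _ a b ab∈B =
  (λ _ _ → proj₁) ,
  λ { _ _ _ w shortest _ _ _ _ _ _ (e₁ , _ , θ₁) (e₂ , _ , θ₂) (e₃ , _ , θ₃) →
        no-three-on-shortest-walk w shortest (e₁ , θ₁) (e₂ , θ₂) (e₃ , θ₃) }
  where open ChosenClasses G pc B endBlock B-injective a b ab∈B
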